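{- Let $n\ge 2$. Then every real matrix whose pattern is $H_n$ has the SSVP.
   Context: $H_n$ (the full lower Hessenberg pattern) is the $n\times n$ $\{0,1\}$-matrix whose $(i,j)$ entry is $0$ if $j>i+1$ and $1$ otherwise. A real matrix has pattern $H_n$ if its $(i,j)$ entry is nonzero exactly when the $(i,j)$ entry of $H_n$ is $1$. A real $n\times n$ matrix $A$ has the SSVP if the zero matrix is the only $n\times n$ matrix $X$ with $A^TX$ symmetric, $XA^T$ symmetric, and $A\circ X=O$ (entrywise product). -}

module Defs where

open import Level using (0ℓ)
open import Algebra.Bundles using (CommutativeRing)
open import Relation.Binary.Structures using (IsTotalOrder)
open import Relation.Nullary using (¬_)
open import Data.Product using (_×_; ∃; ∃-syntax; Σ-syntax)
open import Data.Nat using (ℕ; zero; suc; _≤_; _<_; _<?_)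
open import Relation.Nullary using (yes; no)
open import Data.Fin using (Fin; toℕ; zero; suc)
open import Relation.Binary.PropositionalEquality using (_≡_)

-- The real numbers, given axiomatically as a Dedekind-complete ordered
-- field (unique up to isomorphism).  agda-stdlib has no reals.
record RealField : Set₁ where
  field
    commutativeRing : CommutativeRing 0ℓ 0ℓ
  open CommutativeRing commutativeRing public
  field
    0≉1     : ¬ (0# ≈ 1#)
    inverse : ∀ x → ¬ (x ≈ 0#) → ∃[ y ] (x * y ≈ 1#)
    _≤ᵣ_    : Carrier → Carrier → Set
    ≤ᵣ-isTotalOrder : IsTotalOrder _≈_ _≤ᵣ_
    +-mono-≤ᵣ : ∀ {x y} z → x ≤ᵣ y → (x + z) ≤ᵣ (y + z)
    *-nonneg  : ∀ {x y} → 0# ≤ᵣ x → 0# ≤ᵣ y → 0# ≤ᵣ (x * y)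
    lub : (P : Carrier → Set) → ∃[ x ] P x →
          ∃[ b ] (∀ x → P x → x ≤ᵣ b) →
          ∃[ s ] ((∀ x → P x → x ≤ᵣ s) ×
                  (∀ b → (∀ x → P x → x ≤ᵣ b) → s ≤ᵣ b))

module _ (R : RealField) where
  open RealField R using (Carrier; _≈_; _+_; _*_; 0#)

  Matrix : ℕ → Set
  Matrix n = Fin n → Fin n → Carrier

  ∑ : ∀ {n} → (Fin n → Carrier) → Carrier
  ∑ {zero}  f = 0#
  ∑ {suc n} f = f zero + ∑ (λ i → f (suc i))

  _ᵀ : ∀ {n} → Matrix n → Matrix n
  (A ᵀ) i j = A j i

  _·_ : ∀ {n} → Matrix n → Matrix n → Matrix n
  (A · B) i j = ∑ (λ k → A i k * B k j)

  _∘ₕ_ : ∀ {n} → Matrix n → Matrix n → Matrix n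
  (A ∘ₕ B) i j = A i j * B i j

  IsZero : ∀ {n} → Matrix n → Set
  IsZero A = ∀ i j → A i j ≈ 0#

  Symmetric : ∀ {n} → Matrix n → Set
  Symmetric A = ∀ i j → A i j ≈ A j i

  SSVP : ∀ {n} → Matrix n → Set
  SSVP {n} A = ∀ (X : Matrix n) →
    Symmetric ((A ᵀ) · X) → Symmetric (X · (A ᵀ)) → IsZero (A ∘ₕ X) → IsZero X

  -- A has zero-nonzero pattern P (a {0,1} matrix with entries in ℕ)
  HasPattern : ∀ {n} → (Fin n → Fin n → ℕ) → Matrix n → Set
  HasPattern P A = ∀ i j → (P i j ≡ 0 → A i j ≈ 0#) × (P i j ≡ 1 → ¬ (A i j ≈ 0#))

-- Full lower Hessenberg pattern H_n (0-indexed): entry (i,j) is 0 iff j > i+1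
H : (n : ℕ) → Fin n → Fin n → ℕ
H n i j with suc (toℕ i) <? toℕ j
... | yes _ = 0
... | no  _ = 1

-- A ∘ X = O forces X to vanish on the support of A, i.e. X is supported
-- strictly above the superdiagonal.  Then X Aᵀ is strictly upper triangular,
-- and being symmetric it is zero.  Column k ≥ 1 of X is now recovered from
-- row k - 1 of A: (X Aᵀ)ᵢ,ₖ₋₁ = Σₘ Xᵢₘ Aₖ₋₁,ₘ, where Aₖ₋₁,ₘ = 0 for m > k and,
-- by induction on k, Xᵢₘ = 0 for m < k; so Xᵢₖ Aₖ₋₁,ₖ = 0 with Aₖ₋₁,ₖ ≠ 0.
module Submission where

open import Defs
open import Data.Nat using (ℕ; _≤_)
import Data.Nat as ℕ
import Data.Nat.Properties as ℕ
open import Data.Fin using (Fin; toℕ; suc; inject₁; punchIn)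
import Data.Fin as Fin
import Data.Fin.Properties as Fin
open import Data.Fin.Induction using (<-wellFounded)
open import Induction.WellFounded using (module All)
open import Data.Product using (_,_; proj₁; proj₂; Σ-syntax)
open import Level using (0ℓ)
open import Function using (_∘_)
open import Relation.Nullary using (¬_; yes; no; contradiction)
open import Relation.Binary.PropositionalEquality as ≡ using (_≡_; _≢_)

H-zero : ∀ n (i j : Fin n) → ℕ.suc (toℕ i) ℕ.< toℕ j → H n i j ≡ 0
H-zero n i j i+1<j with ℕ.suc (toℕ i) ℕ.<? toℕ j
... | yes _     = ≡.refl
... | no  i+1≮j = contradiction i+1<j i+1≮j

H-one : ∀ n (i j : Fin n) → toℕ j ≤ ℕ.suc (toℕ i) → H n i j ≡ 1
H-one n i j j≤i+1 with ℕ.suc (toℕ i) ℕ.<? toℕ j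
... | yes i+1<j = contradiction j≤i+1 (ℕ.<⇒≱ i+1<j)
... | no  _     = ≡.refl

predecessor : ∀ {n} (k : Fin n) → toℕ k ≢ 0 → Σ[ j ∈ Fin n ] toℕ k ≡ ℕ.suc (toℕ j)
predecessor Fin.zero k≢0 = contradiction ≡.refl k≢0
predecessor (suc k)  _   = inject₁ k , ≡.cong ℕ.suc (≡.sym (Fin.toℕ-inject₁ k))

module _ (R : RealField) where
  open RealField R
  open import Relation.Binary.Reasoning.Setoid setoid
  open import Algebra.Properties.Semiring.Sum semiring
    using (sum; sum-remove; sum-cong-≋; sum-replicate-zero)

  x*y≈0⇒x≈0 : ∀ {x y} → ¬ y ≈ 0# → x * y ≈ 0# → x ≈ 0#
  x*y≈0⇒x≈0 {x} {y} y≉0 xy≈0 with inverse y y≉0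
  ... | y⁻¹ , yy⁻¹≈1 = begin
    x              ≈⟨ *-identityʳ x ⟨
    x * 1#         ≈⟨ *-congˡ yy⁻¹≈1 ⟨
    x * (y * y⁻¹)  ≈⟨ *-assoc x y y⁻¹ ⟨
    (x * y) * y⁻¹  ≈⟨ *-congʳ xy≈0 ⟩
    0# * y⁻¹       ≈⟨ zeroˡ y⁻¹ ⟩
    0#             ∎

  ∑≡sum : ∀ {n} (f : Fin n → Carrier) → ∑ R f ≡ sum f
  ∑≡sum {ℕ.zero}  f = ≡.refl
  ∑≡sum {ℕ.suc n} f = ≡.cong (f Fin.zero +_) (∑≡sum (f ∘ suc))

  ∑-zero : ∀ {n} (f : Fin n → Carrier) → (∀ k → f k ≈ 0#) → ∑ R f ≈ 0#
  ∑-zero {n} f f≈0 = begin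
    ∑ R f              ≡⟨ ∑≡sum f ⟩
    sum f              ≈⟨ sum-cong-≋ {n} f≈0 ⟩
    sum {n} (λ _ → 0#) ≈⟨ sum-replicate-zero n ⟩
    0#                 ∎

  ∑-single : ∀ {n} (f : Fin n → Carrier) (k : Fin n) →
             (∀ m → m ≢ k → f m ≈ 0#) → ∑ R f ≈ f k
  ∑-single {ℕ.suc n} f k f≈0 = begin
    ∑ R f                       ≡⟨ ∑≡sum f ⟩
    sum f                       ≈⟨ sum-remove f ⟩
    f k + sum (f ∘ punchIn k)   ≡⟨ ≡.cong (f k +_) (∑≡sum (f ∘ punchIn k)) ⟨
    f k + ∑ R (f ∘ punchIn k)   ≈⟨ +-congˡ (∑-zero _ (λ m → f≈0 _ (Fin.punchInᵢ≢i k m))) ⟩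
    f k + 0#                    ≈⟨ +-identityʳ (f k) ⟩
    f k                         ∎

  symmetric-lower-zero⇒zero : ∀ {n} (M : Matrix R n) → Symmetric R M →
    (∀ i j → toℕ j ≤ toℕ i → M i j ≈ 0#) → IsZero R M
  symmetric-lower-zero⇒zero M M-sym M-lower i j with toℕ j ℕ.≤? toℕ i
  ... | yes j≤i = M-lower i j j≤i
  ... | no  j≰i = trans (M-sym i j) (M-lower j i (ℕ.<⇒≤ (ℕ.≰⇒> j≰i)))

  hadamard-zero⇒zero-on-support : ∀ {n} (A X : Matrix R n) → IsZero R (_∘ₕ_ R A X) →
    ∀ i j → ¬ A i j ≈ 0# → X i j ≈ 0#
  hadamard-zero⇒zero-on-support A X A∘X≈0 i j Aij≉0 =
    x*y≈0⇒x≈0 Aij≉0 (trans (*-comm (X i j) (A i j)) (A∘X≈0 i j))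

  module _ {n} {A : Matrix R n} (A∈H : HasPattern R (H n) A) (X : Matrix R n) where

    A-zero : ∀ i j → ℕ.suc (toℕ i) ℕ.< toℕ j → A i j ≈ 0#
    A-zero i j i+1<j = proj₁ (A∈H i j) (H-zero n i j i+1<j)

    A-nonzero : ∀ i j → toℕ j ≤ ℕ.suc (toℕ i) → ¬ A i j ≈ 0#
    A-nonzero i j j≤i+1 = proj₂ (A∈H i j) (H-one n i j j≤i+1)

    XAᵀ-lower-zero : (∀ i k → ¬ A i k ≈ 0# → X i k ≈ 0#) →
      ∀ i j → toℕ j ≤ toℕ i → _·_ R X (_ᵀ R A) i j ≈ 0#
    XAᵀ-lower-zero X≈0-on-A i j j≤i = ∑-zero _ term≈0
      where
      term≈0 : ∀ k → X i k * A j k ≈ 0#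
      term≈0 k with ℕ.suc (toℕ i) ℕ.<? toℕ k
      ... | yes i+1<k = trans (*-congˡ (A-zero j k (ℕ.≤-trans (ℕ.s≤s (ℕ.s≤s j≤i)) i+1<k))) (zeroʳ _)
      ... | no  i+1≮k = trans (*-congʳ (X≈0-on-A i k (A-nonzero i k (ℕ.≮⇒≥ i+1≮k)))) (zeroˡ _)

    column-zero : IsZero R (_·_ R X (_ᵀ R A)) → ∀ i j k → toℕ k ≡ ℕ.suc (toℕ j) →
      (∀ m → toℕ m ℕ.< toℕ k → X i m ≈ 0#) → X i k ≈ 0#
    column-zero XAᵀ≈0 i j k k≡j+1 earlier≈0 =
      x*y≈0⇒x≈0 (A-nonzero j k (ℕ.≤-reflexive k≡j+1)) (begin
        X i k * A j k          ≈⟨ ∑-single _ k term≈0 ⟨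
        _·_ R X (_ᵀ R A) i j   ≈⟨ XAᵀ≈0 i j ⟩
        0#                     ∎)
      where
      term≈0 : ∀ m → m ≢ k → X i m * A j m ≈ 0#
      term≈0 m m≢k with toℕ m ℕ.<? toℕ k
      ... | yes m<k = trans (*-congʳ (earlier≈0 m m<k)) (zeroˡ _)
      ... | no  m≮k = trans (*-congˡ (A-zero j m j+1<m)) (zeroʳ _)
        where
        j+1<m : ℕ.suc (toℕ j) ℕ.< toℕ m
        j+1<m = ≡.subst (ℕ._< toℕ m) k≡j+1
                  (ℕ.≤∧≢⇒< (ℕ.≮⇒≥ m≮k) (m≢k ∘ Fin.toℕ-injective ∘ ≡.sym))

    XAᵀ-zero⇒zero : (∀ i k → ¬ A i k ≈ 0# → X i k ≈ 0#) →
      IsZero R (_·_ R X (_ᵀ R A)) → IsZero R X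
    XAᵀ-zero⇒zero X≈0-on-A XAᵀ≈0 i = All.wfRec <-wellFounded 0ℓ (λ k → X i k ≈ 0#) step
      where
      step : ∀ k → (∀ {m} → m Fin.< k → X i m ≈ 0#) → X i k ≈ 0#
      step k earlier≈0 with toℕ k ℕ.≟ 0
      ... | yes k≡0 = X≈0-on-A i k (A-nonzero i k (≡.subst (_≤ _) (≡.sym k≡0) ℕ.z≤n))
      ... | no  k≢0 with predecessor k k≢0
      ...   | j , k≡j+1 = column-zero XAᵀ≈0 i j k k≡j+1 (λ m → earlier≈0)

lemma4p6 : (R : RealField) (n : ℕ) → 2 ≤ n →
    (A : Matrix R n) → HasPattern R (H n) A → SSVP R A
lemma4p6 R n _ A A∈H X _ XAᵀ-sym A∘X≈0 =
  XAᵀ-zero⇒zero R A∈H X X≈0-on-A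
    (symmetric-lower-zero⇒zero R (_·_ R X (_ᵀ R A)) XAᵀ-sym
      (XAᵀ-lower-zero R A∈H X X≈0-on-A))
  where
  open RealField R using (_≈_; 0#)
  X≈0-on-A : ∀ i k → ¬ A i k ≈ 0# → X i k ≈ 0#
  X≈0-on-A = hadamard-zero⇒zero-on-support R A X A∘X≈0
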